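{- Let $K_n$ be the complete graph on $n$ vertices with price function $P$, and label its vertices so that their prices satisfy $p^{1}\le p^{2}\le\cdots\le p^{n}$. Then for every integer $t$ with $1\le t<n$, \[ \pi_{P}^{t}(K_{n})=\sum_{i=t+1}^{n}(p^{i}-1)+p^{n}(t-1)+1. \]
   Context: A configuration of $k$ pebbles on a graph $G$ is a function $C:V(G)\to\mathbb{Z}_{\ge 0}$ with $\sum_{v}C(v)=k$. A price function is a function $P:V(G)\to\mathbb{Z}_{\ge 2}$. A pebbling move along an edge $v_hv_k$ removes $P(v_h)$ pebbles from $v_h$ and adds one pebble to $v_k$; it is allowed only if the result has no negative values. A configuration $C'$ is derivable from $C$ if it is obtained from $C$ by a finite sequence of pebbling moves. A configuration covers a set of vertices if it is nonzero at each of them. A configuration $C$ is $t$-solvable if for every set of $t$ vertices there is a configuration derivable from $C$ covering that set. For $1\le t\le n$, $\pi_P^t(G)$ is the minimum $k$ such that every configuration of $k$ pebbles on $G$ (with price function $P$) is $t$-solvable. -}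

module Defs where

open import Data.Nat using (ℕ; zero; suc; _+_; _*_; _∸_; _≤_; _<_)
open import Data.Fin using (Fin; toℕ; _≟_)
import Data.Fin as F
open import Data.Fin.Subset using (Subset; _∈_; ∣_∣)
open import Data.Product using (Σ; _×_; ∃)
open import Relation.Nullary using (¬_; yes; no)
open import Relation.Binary.PropositionalEquality using (_≡_; _≢_)
open import Relation.Binary.Construct.Closure.ReflexiveTransitive using (Star)

sumFin : (n : ℕ) → (Fin n → ℕ) → ℕ
sumFin zero    f = 0
sumFin (suc n) f = f F.zero + sumFin n (λ i → f (F.suc i))

Config : ℕ → Set
Config n = Fin n → ℕ

size : {n : ℕ} → Config n → ℕ
size {n} C = sumFin n C

IsPrice : {n : ℕ} → (Fin n → ℕ) → Set
IsPrice P = ∀ v → 2 ≤ P v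

move : {n : ℕ} → (Fin n → ℕ) → Config n → Fin n → Fin n → Config n
move P C u v w with w ≟ u
... | yes _ = C w ∸ P u
... | no _ with w ≟ v
...   | yes _ = suc (C w)
...   | no _  = C w

-- a single pebbling move on K_n (every pair of distinct vertices is an edge);
-- allowed only when u has at least P u pebbles (no negative values)
data Step {n : ℕ} (P : Fin n → ℕ) (C : Config n) : Config n → Set where
  step : (u v : Fin n) → u ≢ v → P u ≤ C u → Step P C (move P C u v)

Derivable : {n : ℕ} → (Fin n → ℕ) → Config n → Config n → Set
Derivable P = Star (Step P)

Covers : {n : ℕ} → Config n → Subset n → Set
Covers C S = ∀ v → v ∈ S → 0 < C v

Solvable : {n : ℕ} → (Fin n → ℕ) → ℕ → Config n → Set
Solvable {n} P t C =
  (S : Subset n) → ∣ S ∣ ≡ t → ∃ λ C' → Derivable P C C' × Covers C' S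

AllSolvable : {n : ℕ} → (Fin n → ℕ) → ℕ → ℕ → Set
AllSolvable {n} P t k = (C : Config n) → size C ≡ k → Solvable P t C

PebblingNumber : {n : ℕ} → (Fin n → ℕ) → ℕ → ℕ → Set
PebblingNumber P t m = AllSolvable P t m × (∀ k → k < m → ¬ AllSolvable P t k)

-- Σ_{i=t+1}^{n} (p^i - 1) with 1-based labels, i.e. 0-based indices i ≥ t
tailSum : {n : ℕ} → (Fin n → ℕ) → ℕ → ℕ
tailSum {n} P t = sumFin n (λ i → if< t (toℕ i) (P i ∸ 1))
  where
  if< : ℕ → ℕ → ℕ → ℕ
  if< t i x with Data.Nat._<?_ i t
  ... | yes _ = 0
  ... | no _  = x

-- Fix a target set S with |S| = t and let M be the largest price. Call a target
-- uncovered when it holds no pebble, and count the spare moves Σ ⌊(C x − [x ∈ S]) / P x⌋ that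
-- can be made without emptying a target. While some target is uncovered and there are at least
-- as many spare moves as uncovered targets, a spare move onto an uncovered target covers it
-- and costs at most one spare move, so the greedy strategy covers S. Counting pebbles vertex
-- by vertex gives  size C + M·uncovered ≤ M·(spare + t) + Σ_{x ∉ S} (P x − 1),  and since
-- prices are sorted the last sum is at most Σ_{i ≥ t} (p^i − 1); for the stated number of
-- pebbles this forces uncovered ≤ spare.
--
-- The potential Σ_{x ∈ S} ⌈C x / P x⌉ + Σ_{x ∉ S} ⌊C x / P x⌋ never increases
-- under a move (the source loses exactly one, the target gains at most one) and is at least |S|
-- once S is covered. Taking S to be the t cheapest vertices, the configuration with P x − 1
-- pebbles on every other vertex and M (t − 1) more on the most expensive one, and any
-- configuration below it, has potential at most t − 1.
module Submission where

open import Defs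
open import Data.Nat using (ℕ; zero; suc; _+_; _*_; _∸_; _⊓_; _≤_; _<_; z≤n; s≤s;
                            NonZero; >-nonZero; >-nonZero⁻¹)
open import Data.Fin using (Fin; toℕ; fromℕ; zero; suc; _≟_)
open import Data.Bool.Base using (Bool; true; false; if_then_else_; T)
import Data.Fin.Properties as Fin
open import Data.Fin.Subset using (Subset; ∣_∣)
open import Data.Fin.Subset.Properties using (∣p∣≤n)
open import Data.Nat.DivMod
open import Data.Nat.Properties hiding (_≟_)
import Data.Nat.Properties as ℕ
open import Data.Nat.Solver using (module +-*-Solver)
open import Data.Product using (∃; _×_; _,_)
open import Data.Unit using (tt)
open import Data.Vec.Base using (lookup; tabulate; _∷_; [])
open import Data.Vec.Functional using (updateAt)
open import Data.Vec.Functional.Properties using (updateAt-updates; updateAt-minimal)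
open import Data.Vec.Properties using (lookup∘tabulate; lookup⇒[]=; []=⇒lookup)
open import Function using (_∘_)
open import Relation.Binary.Construct.Closure.ReflexiveTransitive using (ε; _◅_)
open import Relation.Binary.PropositionalEquality
open import Relation.Nullary using (¬_; does; yes; no; contradiction)
open import Relation.Nullary.Decidable using (dec-true; dec-false)
open import Algebra.Properties.CommutativeSemigroup +-commutativeSemigroup
  using (interchange; x∙yz≈y∙xz; xy∙z≈y∙xz)

sumFin-cong : ∀ n {f g : Fin n → ℕ} → (∀ i → f i ≡ g i) → sumFin n f ≡ sumFin n g
sumFin-cong zero    f≗g = refl
sumFin-cong (suc n) f≗g = cong₂ _+_ (f≗g zero) (sumFin-cong n (f≗g ∘ suc))

sumFin-mono-≤ : ∀ n {f g : Fin n → ℕ} → (∀ i → f i ≤ g i) → sumFin n f ≤ sumFin n g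
sumFin-mono-≤ zero    f≤g = z≤n
sumFin-mono-≤ (suc n) f≤g = +-mono-≤ (f≤g zero) (sumFin-mono-≤ n (f≤g ∘ suc))

sumFin-distrib-+ : ∀ n (f g : Fin n → ℕ) →
                   sumFin n (λ i → f i + g i) ≡ sumFin n f + sumFin n g
sumFin-distrib-+ zero    f g = refl
sumFin-distrib-+ (suc n) f g = begin
  f zero + g zero + sumFin n (λ i → f (suc i) + g (suc i))
    ≡⟨ cong (f zero + g zero +_) (sumFin-distrib-+ n (f ∘ suc) (g ∘ suc)) ⟩
  f zero + g zero + (sumFin n (f ∘ suc) + sumFin n (g ∘ suc))
    ≡⟨ interchange (f zero) (g zero) _ _ ⟩
  f zero + sumFin n (f ∘ suc) + (g zero + sumFin n (g ∘ suc)) ∎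
  where open ≡-Reasoning

sumFin-distribˡ-* : ∀ n k (f : Fin n → ℕ) → sumFin n (λ i → k * f i) ≡ k * sumFin n f
sumFin-distribˡ-* zero    k f = sym (*-zeroʳ k)
sumFin-distribˡ-* (suc n) k f =
  trans (cong (k * f zero +_) (sumFin-distribˡ-* n k (f ∘ suc))) (sym (*-distribˡ-+ k (f zero) _))

sumFin-zero : ∀ n → sumFin n (λ _ → 0) ≡ 0
sumFin-zero zero    = refl
sumFin-zero (suc n) = sumFin-zero n

sumFin-point : ∀ n (v : Fin n) c → sumFin n (λ x → if does (x ≟ v) then c else 0) ≡ c
sumFin-point (suc n) zero    c = trans (cong (c +_) (sumFin-zero n)) (+-identityʳ c)
sumFin-point (suc n) (suc v) c = sumFin-point n v c

sumFin>0⇒∃>0 : ∀ n (f : Fin n → ℕ) → 0 < sumFin n f → ∃ λ i → 0 < f i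
sumFin>0⇒∃>0 (suc n) f sum>0 with f zero in eq
... | suc _ = zero , subst (0 <_) (sym eq) (s≤s z≤n)
... | zero with sumFin>0⇒∃>0 n (f ∘ suc) sum>0
...   | i , fi>0 = suc i , fi>0

sumFin≡0⇒≡0 : ∀ n (f : Fin n → ℕ) → sumFin n f ≡ 0 → ∀ i → f i ≡ 0
sumFin≡0⇒≡0 (suc n) f sum≡0 zero    = m+n≡0⇒m≡0 (f zero) sum≡0
sumFin≡0⇒≡0 (suc n) f sum≡0 (suc i) = sumFin≡0⇒≡0 n (f ∘ suc) (m+n≡0⇒n≡0 (f zero) sum≡0) i

sumFin-≤-except : ∀ n {f g : Fin n → ℕ} (v : Fin n) {a b} → a + f v ≤ b + g v →
                  (∀ x → x ≢ v → f x ≤ g x) → a + sumFin n f ≤ b + sumFin n g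
sumFin-≤-except (suc n) {f} {g} zero {a} {b} at-v elsewhere = begin
  a + (f zero + sumFin n (f ∘ suc)) ≡⟨ +-assoc a _ _ ⟨
  a + f zero + sumFin n (f ∘ suc)   ≤⟨ +-mono-≤ at-v (sumFin-mono-≤ n (λ x → elsewhere (suc x) λ ())) ⟩
  b + g zero + sumFin n (g ∘ suc)   ≡⟨ +-assoc b _ _ ⟩
  b + (g zero + sumFin n (g ∘ suc)) ∎
  where open ≤-Reasoning
sumFin-≤-except (suc n) {f} {g} (suc v) {a} {b} at-v elsewhere = begin
  a + (f zero + sumFin n (f ∘ suc)) ≡⟨ x∙yz≈y∙xz a (f zero) _ ⟩
  f zero + (a + sumFin n (f ∘ suc))
    ≤⟨ +-mono-≤ (elsewhere zero λ ())
                (sumFin-≤-except n v at-v λ x x≢v → elsewhere (suc x) (x≢v ∘ Fin.suc-injective)) ⟩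
  g zero + (b + sumFin n (g ∘ suc)) ≡⟨ x∙yz≈y∙xz (g zero) b _ ⟩
  b + (g zero + sumFin n (g ∘ suc)) ∎
  where open ≤-Reasoning

sumFin-≤-except₂ : ∀ n {f g : Fin n → ℕ} {u v : Fin n} {a b c d} → u ≢ v →
                   a + f u ≤ b + g u → c + f v ≤ d + g v →
                   (∀ x → x ≢ u → x ≢ v → f x ≤ g x) → a + c + sumFin n f ≤ b + d + sumFin n g
sumFin-≤-except₂ n {f} {g} {u} {v} {a} {b} {c} {d} u≢v at-u at-v elsewhere = begin
  a + c + sumFin n f   ≡⟨ xy∙z≈y∙xz a c _ ⟩
  c + (a + sumFin n f) ≤⟨ +-monoʳ-≤ c (sumFin-≤-except n u a+f≤b+h f≤h) ⟩
  c + (b + sumFin n h) ≡⟨ x∙yz≈y∙xz c b _ ⟩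
  b + (c + sumFin n h) ≤⟨ +-monoʳ-≤ b (sumFin-≤-except n v c+h≤d+g h≤g) ⟩
  b + (d + sumFin n g) ≡⟨ +-assoc b d _ ⟨
  b + d + sumFin n g   ∎
  where
  open ≤-Reasoning
  h : Fin n → ℕ
  h = updateAt f u (λ _ → g u)
  a+f≤b+h : a + f u ≤ b + h u
  a+f≤b+h rewrite updateAt-updates u {λ _ → g u} f = at-u
  f≤h : ∀ x → x ≢ u → f x ≤ h x
  f≤h x x≢u = ≤-reflexive (sym (updateAt-minimal x u f x≢u))
  c+h≤d+g : c + h v ≤ d + g v
  c+h≤d+g rewrite updateAt-minimal v u {λ _ → g u} f (u≢v ∘ sym) = at-v
  h≤g : ∀ x → x ≢ v → h x ≤ g x
  h≤g x x≢v with x Fin.≟ u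
  ... | yes refl = ≤-reflexive (updateAt-updates u f)
  ... | no  x≢u  = subst (_≤ g x) (sym (updateAt-minimal x u f x≢u)) (elsewhere x x≢u x≢v)

indicator : Bool → ℕ
indicator b = if b then 1 else 0

c<indicator⇒ : ∀ {b c} → c < indicator b → b ≡ true × c ≡ 0
c<indicator⇒ {true}  c<1 = refl , n<1⇒n≡0 c<1
c<indicator⇒ {false} ()

sumFin-indicator : ∀ {n} (S : Subset n) → sumFin n (λ x → indicator (lookup S x)) ≡ ∣ S ∣
sumFin-indicator []          = refl
sumFin-indicator (true  ∷ S) = cong suc (sumFin-indicator S)
sumFin-indicator (false ∷ S) = sumFin-indicator S

firstVertices : ∀ {n} → ℕ → Subset n
firstVertices k = tabulate (λ x → does (toℕ x <? k))

∣firstVertices∣ : ∀ n {k} → k ≤ n → ∣ firstVertices {n} k ∣ ≡ k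
∣firstVertices∣ zero           z≤n       = refl
∣firstVertices∣ (suc n) {zero} z≤n       = ∣firstVertices∣ n z≤n
∣firstVertices∣ (suc n)        (s≤s k≤n) = cong suc (∣firstVertices∣ n k≤n)

∈firstVertices⇒< : ∀ {n k} {x : Fin n} → lookup (firstVertices k) x ≡ true → toℕ x < k
∈firstVertices⇒< {k = k} {x} x∈ = <ᵇ⇒< (toℕ x) k (subst T (sym x<ᵇk) tt)
  where
  x<ᵇk : does (toℕ x <? k) ≡ true
  x<ᵇk = trans (sym (lookup∘tabulate (λ y → does (toℕ y <? k)) x)) x∈

sumOutside : ∀ {n} → Subset n → (Fin n → ℕ) → ℕ
sumOutside {n} S q = sumFin n (λ x → if lookup S x then 0 else q x)

Monotone : ∀ {n} → (Fin n → ℕ) → Set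
Monotone q = ∀ i j → toℕ i ≤ toℕ j → q i ≤ q j

sumOutside-firstVertices-suc : ∀ n k {c} (q : Fin n → ℕ) → suc k ≤ n → (∀ x → c ≤ q x) →
  c + sumOutside (firstVertices (suc k)) q ≤ sumOutside (firstVertices k) q
sumOutside-firstVertices-suc (suc n) zero    q _         c≤q = +-monoˡ-≤ _ (c≤q zero)
sumOutside-firstVertices-suc (suc n) (suc k) q (s≤s k<n) c≤q =
  sumOutside-firstVertices-suc n k (q ∘ suc) k<n (c≤q ∘ suc)

sumOutside≤sumOutside-firstVertices : ∀ {n} (S : Subset n) (q : Fin n → ℕ) → Monotone q →
  sumOutside S q ≤ sumOutside (firstVertices ∣ S ∣) q
sumOutside≤sumOutside-firstVertices []          q q↑ = z≤n
sumOutside≤sumOutside-firstVertices (true  ∷ S) q q↑ =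
  sumOutside≤sumOutside-firstVertices S (q ∘ suc) (λ i j → q↑ (suc i) (suc j) ∘ s≤s)
sumOutside≤sumOutside-firstVertices {suc n} (false ∷ S) q q↑ = ≤-trans
  (+-monoʳ-≤ (q zero)
    (sumOutside≤sumOutside-firstVertices S (q ∘ suc) (λ i j → q↑ (suc i) (suc j) ∘ s≤s)))
  (q₀-into-tail ∣ S ∣ (∣p∣≤n S))
  where
  q₀-into-tail : ∀ k → k ≤ n →
    q zero + sumOutside (firstVertices k) (q ∘ suc) ≤ sumOutside (firstVertices k) q
  q₀-into-tail zero    _   = ≤-refl
  q₀-into-tail (suc k) k<n =
    sumOutside-firstVertices-suc n k (q ∘ suc) k<n (λ x → q↑ zero (suc x) z≤n)

truncate : ∀ n (B : Fin n → ℕ) k → k ≤ sumFin n B →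
           ∃ λ (C : Fin n → ℕ) → (∀ x → C x ≤ B x) × sumFin n C ≡ k
truncate zero    B k k≤0 = B , (λ ()) , sym (n≤0⇒n≡0 k≤0)
truncate (suc n) B k k≤ΣB with truncate n (B ∘ suc) (k ∸ B zero) (m≤n+o⇒m∸n≤o k (B zero) k≤ΣB)
... | C , C≤B , ΣC≡ = C′ , C′≤B , trans (cong (B zero ⊓ k +_) ΣC≡) (m⊓n+n∸m≡n (B zero) k)
  where
  C′ : Fin (suc n) → ℕ
  C′ zero    = B zero ⊓ k
  C′ (suc x) = C x
  C′≤B : ∀ x → C′ x ≤ B x
  C′≤B zero    = m⊓n≤m (B zero) k
  C′≤B (suc x) = C≤B x

-- The summand of tailSum is local to its definition; unifying against sumFin recovers it.
summandOf : ∀ {n} {f : Fin n → ℕ} (s : ℕ) → s ≡ sumFin n f → Fin n → ℕ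
summandOf {f = f} _ _ = f

tailSum≡sumOutside : ∀ {n} (P : Fin n → ℕ) t →
                     tailSum P t ≡ sumOutside (firstVertices t) (λ x → P x ∸ 1)
tailSum≡sumOutside {n} P t = sumFin-cong n pointwise
  where
  pointwise : ∀ x → summandOf (tailSum P t) refl x ≡
                    (if lookup (firstVertices t) x then 0 else P x ∸ 1)
  pointwise x rewrite lookup∘tabulate (λ y → does (toℕ y <? t)) x with toℕ x <? t
  ... | yes x<t rewrite dec-true  (toℕ x <? t) x<t = refl
  ... | no  x≮t rewrite dec-false (toℕ x <? t) x≮t = refl

move-source : ∀ {n} (P : Fin n → ℕ) C u v → move P C u v u ≡ C u ∸ P u
move-source P C u v with u ≟ u
... | yes _   = refl
... | no  u≢u = contradiction refl u≢u

move-target : ∀ {n} (P : Fin n → ℕ) C {u v} → u ≢ v → move P C u v v ≡ suc (C v)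
move-target P C {u} {v} u≢v with v ≟ u
... | yes v≡u = contradiction (sym v≡u) u≢v
... | no  _ with v ≟ v
...   | yes _   = refl
...   | no  v≢v = contradiction refl v≢v

move-elsewhere : ∀ {n} (P : Fin n → ℕ) C {u v} x → x ≢ u → x ≢ v → move P C u v x ≡ C x
move-elsewhere P C {u} {v} x x≢u x≢v with x ≟ u
... | yes x≡u = contradiction x≡u x≢u
... | no  _ with x ≟ v
...   | yes x≡v = contradiction x≡v x≢v
...   | no  _   = refl

module _ {n : ℕ} .{{_ : NonZero n}} where

  [m+o]/n≡1+[m∸n+o]/n : ∀ {m} o → n ≤ m → (m + o) / n ≡ suc ((m ∸ n + o) / n)
  [m+o]/n≡1+[m∸n+o]/n {m} o n≤m = begin
    (m + o) / n           ≡⟨ m/n≡1+[m∸n]/n (≤-trans n≤m (m≤m+n m o)) ⟩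
    suc ((m + o ∸ n) / n) ≡⟨ cong (λ k → suc (k / n)) (+-∸-comm o n≤m) ⟩
    suc ((m ∸ n + o) / n) ∎
    where open ≡-Reasoning

  [1+m]/n≤1+m/n : ∀ m → suc m / n ≤ suc (m / n)
  [1+m]/n≤1+m/n m = begin
    suc m / n             ≡⟨ cong (_/ n) (+-comm 1 m) ⟩
    (m + 1) / n           ≤⟨ /-monoˡ-≤ n (+-monoʳ-≤ m (>-nonZero⁻¹ n)) ⟩
    (m + n) / n           ≡⟨ m/n≡1+[m∸n]/n (m≤n+m n m) ⟩
    suc ((m + n ∸ n) / n) ≡⟨ cong (λ k → suc (k / n)) (m+n∸n≡m m n) ⟩
    suc (m / n)           ∎
    where open ≤-Reasoning

  m<[1+m/n]*n : ∀ m → m < suc (m / n) * n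
  m<[1+m/n]*n m = begin-strict
    m                 ≡⟨ m≡m%n+[m/n]*n m n ⟩
    m % n + m / n * n <⟨ +-monoˡ-< (m / n * n) (m%n<n m n) ⟩
    n + m / n * n     ∎
    where open ≤-Reasoning

  m≤[n∸1]+k*n⇒m/n≤k : ∀ {m} k → m ≤ (n ∸ 1) + k * n → m / n ≤ k
  m≤[n∸1]+k*n⇒m/n≤k {m} k m≤ = <⇒≤pred (m<n*o⇒m/o<n (begin-strict
    m                 ≤⟨ m≤ ⟩
    (n ∸ 1) + k * n   <⟨ +-monoˡ-< (k * n) (m≤pred[n]⇒suc[m]≤n ≤-refl) ⟩
    n + k * n         ∎))
    where open ≤-Reasoning

  0<[m∸s]/n⇒n+s≤m : ∀ {m} s → 0 < (m ∸ s) / n → n + s ≤ m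
  0<[m∸s]/n⇒n+s≤m {m} s pos = m≤o∸n⇒m+n≤o n (<⇒≤ s<m) n≤m∸s
    where
    n≤m∸s : n ≤ m ∸ s
    n≤m∸s = m/n≢0⇒n≤m (>⇒≢ pos)
    s<m : s < m
    s<m = m∸n≢0⇒n<m (>⇒≢ (<-≤-trans (>-nonZero⁻¹ n) n≤m∸s))

  [m∸s]/n≡1+[m∸n∸s]/n : ∀ {m} s → 0 < (m ∸ s) / n → (m ∸ s) / n ≡ suc ((m ∸ n ∸ s) / n)
  [m∸s]/n≡1+[m∸n∸s]/n {m} s pos = begin
    (m ∸ s) / n           ≡⟨ m/n≡1+[m∸n]/n (m/n≢0⇒n≤m (>⇒≢ pos)) ⟩
    suc ((m ∸ s ∸ n) / n) ≡⟨ cong (λ k → suc (k / n)) m∸s∸n≡m∸n∸s ⟩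
    suc ((m ∸ n ∸ s) / n) ∎
    where
    open ≡-Reasoning
    m∸s∸n≡m∸n∸s : m ∸ s ∸ n ≡ m ∸ n ∸ s
    m∸s∸n≡m∸n∸s = trans (∸-+-assoc m s n) (trans (cong (m ∸_) (+-comm s n)) (sym (∸-+-assoc m n s)))

pebbles+M*uncovered≤ : ∀ b c {p M} .{{_ : NonZero p}} → p ≤ M →
  c + M * (indicator b ∸ c) ≤ M * ((c ∸ indicator b) / p + indicator b) + (if b then 0 else p ∸ 1)
pebbles+M*uncovered≤ false c {p@(suc p-1)} {M} p≤M = begin
  c + M * (0 ∸ c)       ≡⟨ cong (λ k → c + M * k) (0∸n≡0 c) ⟩
  c + M * 0             ≡⟨ trans (cong (c +_) (*-zeroʳ M)) (+-identityʳ c) ⟩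
  c                     ≤⟨ ≤-pred (m<[1+m/n]*n c) ⟩
  p-1 + c / p * p       ≡⟨ +-comm p-1 _ ⟩
  c / p * p + p-1       ≤⟨ +-monoˡ-≤ p-1 (*-monoʳ-≤ (c / p) p≤M) ⟩
  c / p * M + p-1       ≡⟨ cong (_+ p-1) (trans (*-comm (c / p) M) (cong (M *_) (sym (+-identityʳ _)))) ⟩
  M * (c / p + 0) + p-1 ∎
  where open ≤-Reasoning
pebbles+M*uncovered≤ true zero {p} {M} p≤M = begin
  M * 1               ≡⟨ cong (λ k → M * (k + 1)) (0/n≡0 p) ⟨
  M * (0 / p + 1)     ≤⟨ m≤m+n _ 0 ⟩
  M * (0 / p + 1) + 0 ∎
  where open ≤-Reasoning
pebbles+M*uncovered≤ true (suc c) {p} {M} p≤M = begin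
  suc c + M * (0 ∸ c) ≡⟨ cong (λ k → suc c + M * k) (0∸n≡0 c) ⟩
  suc c + M * 0       ≡⟨ trans (cong (suc c +_) (*-zeroʳ M)) (+-identityʳ _) ⟩
  suc c               ≤⟨ m<[1+m/n]*n c ⟩
  suc (c / p) * p     ≤⟨ *-monoʳ-≤ (suc (c / p)) p≤M ⟩
  suc (c / p) * M     ≡⟨ trans (*-comm (suc (c / p)) M) (cong (M *_) (+-comm 1 _)) ⟩
  M * (c / p + 1)     ≤⟨ m≤m+n _ 0 ⟩
  M * (c / p + 1) + 0 ∎
  where open ≤-Reasoning

m+n*k+1+n*u≤n*[f+1+k]+m⇒u≤f : ∀ m n k u f .{{_ : NonZero n}} →
  m + n * k + 1 + n * u ≤ n * (f + suc k) + m → u ≤ f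
m+n*k+1+n*u≤n*[f+1+k]+m⇒u≤f m n k u f hyp =
  ≤-pred (*-cancelˡ-< n u (suc f) (+-cancelˡ-≤ (m + n * k) _ _ (subst₂ _≤_ lhs rhs hyp)))
  where
  open +-*-Solver
  lhs : m + n * k + 1 + n * u ≡ (m + n * k) + suc (n * u)
  lhs = solve 4 (λ m n k u → m :+ n :* k :+ con 1 :+ n :* u := (m :+ n :* k) :+ (con 1 :+ n :* u))
              refl m n k u
  rhs : n * (f + suc k) + m ≡ (m + n * k) + n * suc f
  rhs = solve 4 (λ m n k f → n :* (f :+ (con 1 :+ k)) :+ m := (m :+ n :* k) :+ n :* (con 1 :+ f))
              refl m n k f

module Potential {N : ℕ} (P : Fin N → ℕ) {{_ : ∀ {x} → NonZero (P x)}} where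

  offset : Subset N → Fin N → ℕ
  offset S x = if lookup S x then P x ∸ 1 else 0

  potential : Subset N → Config N → ℕ
  potential S C = sumFin N (λ x → (C x + offset S x) / P x)

  potential-step : ∀ S {C C′} → Step P C C′ → potential S C′ ≤ potential S C
  potential-step S {C} (step u v u≢v Pu≤Cu) = ≤-pred (sumFin-≤-except₂ N u≢v at-u at-v elsewhere)
    where
    at-u : suc ((move P C u v u + offset S u) / P u) ≤ (C u + offset S u) / P u
    at-u rewrite move-source P C u v = ≤-reflexive (sym ([m+o]/n≡1+[m∸n+o]/n (offset S u) Pu≤Cu))
    at-v : (move P C u v v + offset S v) / P v ≤ suc ((C v + offset S v) / P v)
    at-v rewrite move-target P C u≢v = [1+m]/n≤1+m/n (C v + offset S v)
    elsewhere : ∀ x → x ≢ u → x ≢ v →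
                (move P C u v x + offset S x) / P x ≤ (C x + offset S x) / P x
    elsewhere x x≢u x≢v rewrite move-elsewhere P C x x≢u x≢v = ≤-refl

  potential-derivable : ∀ S {C C′} → Derivable P C C′ → potential S C′ ≤ potential S C
  potential-derivable S ε       = ≤-refl
  potential-derivable S (s ◅ d) = ≤-trans (potential-derivable S d) (potential-step S s)

  ∣S∣≤potential : ∀ S {C} → Covers C S → ∣ S ∣ ≤ potential S C
  ∣S∣≤potential S {C} covers = begin
    ∣ S ∣                                    ≡⟨ sumFin-indicator S ⟨
    sumFin N (λ x → indicator (lookup S x)) ≤⟨ sumFin-mono-≤ N at ⟩
    potential S C                            ∎
    where
    open ≤-Reasoning
    at : ∀ x → indicator (lookup S x) ≤ (C x + offset S x) / P x
    at x with lookup S x in x∈S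
    ... | false = z≤n
    ... | true  = m≥n⇒m/n>0 (≤-trans (m≤n+m∸n (P x) 1)
                                      (+-monoˡ-≤ (P x ∸ 1) (covers x (lookup⇒[]= x S x∈S))))

  potential<∣S∣⇒¬covers : ∀ S {C C′} → potential S C < ∣ S ∣ → Derivable P C C′ → ¬ Covers C′ S
  potential<∣S∣⇒¬covers S pot<∣S∣ C⇒C′ covers =
    <⇒≱ pot<∣S∣ (≤-trans (∣S∣≤potential S covers) (potential-derivable S C⇒C′))

module Greedy {N : ℕ} (P : Fin N → ℕ) {{_ : ∀ {x} → NonZero (P x)}} (S : Subset N) where

  demand : Fin N → ℕ
  demand x = indicator (lookup S x)

  uncovered : Config N → ℕ
  uncovered C = sumFin N (λ x → demand x ∸ C x)

  spareMoves : Config N → ℕ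
  spareMoves C = sumFin N (λ x → (C x ∸ demand x) / P x)

  uncovered≡0⇒covers : ∀ {C} → uncovered C ≡ 0 → Covers C S
  uncovered≡0⇒covers {C} U≡0 v v∈S = m∸n≡0⇒m≤n 1∸Cv≡0
    where
    1∸Cv≡0 : 1 ∸ C v ≡ 0
    1∸Cv≡0 = subst (λ b → indicator b ∸ C v ≡ 0) ([]=⇒lookup v∈S)
                   (sumFin≡0⇒≡0 N (λ x → demand x ∸ C x) U≡0 v)

  uncovered-target : ∀ {C} → 0 < uncovered C → ∃ λ w → lookup S w ≡ true × C w ≡ 0
  uncovered-target {C} U>0 =
    let w , pos = sumFin>0⇒∃>0 N (λ x → demand x ∸ C x) U>0
    in  w , c<indicator⇒ (m∸n≢0⇒n<m (>⇒≢ pos))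

  greedy-step : ∀ {C} → 0 < uncovered C → uncovered C ≤ spareMoves C →
                ∃ λ C′ → Step P C C′ × uncovered C′ < uncovered C × uncovered C′ ≤ spareMoves C′
  greedy-step {C} U>0 U≤F
    with uncovered-target {C} U>0 | sumFin>0⇒∃>0 N (λ x → (C x ∸ demand x) / P x) (<-≤-trans U>0 U≤F)
  ... | w , w∈S , Cw≡0 | v , spare>0 = C′ , step v w v≢w Pv≤Cv , U′<U , U′≤F′
    where
    C′ : Config N
    C′ = move P C v w
    Pv+demand≤Cv : P v + demand v ≤ C v
    Pv+demand≤Cv = 0<[m∸s]/n⇒n+s≤m (demand v) spare>0
    Pv≤Cv : P v ≤ C v
    Pv≤Cv = m+n≤o⇒m≤o (P v) Pv+demand≤Cv
    no-spare-at-w : (C w ∸ demand w) / P w ≡ 0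
    no-spare-at-w rewrite Cw≡0 | 0∸n≡0 (demand w) = 0/n≡0 (P w)
    v≢w : v ≢ w
    v≢w refl = >⇒≢ spare>0 no-spare-at-w
    v-stays-covered : demand v ∸ C′ v ≡ 0
    v-stays-covered = trans (cong (demand v ∸_) (move-source P C v w))
      (m≤n⇒m∸n≡0 (m+n≤o⇒m≤o∸n (demand v) (subst (_≤ C v) (+-comm (P v) (demand v)) Pv+demand≤Cv)))
    U-at-w : suc (demand w ∸ C′ w) ≤ demand w ∸ C w
    U-at-w rewrite move-target P C v≢w | w∈S | Cw≡0 = ≤-refl
    U-at-v : demand v ∸ C′ v ≤ demand v ∸ C v
    U-at-v = subst (_≤ demand v ∸ C v) (sym v-stays-covered) z≤n
    F-at-v : (C v ∸ demand v) / P v ≤ suc ((C′ v ∸ demand v) / P v)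
    F-at-v rewrite move-source P C v w = ≤-reflexive ([m∸s]/n≡1+[m∸n∸s]/n (demand v) spare>0)
    F-at-w : (C w ∸ demand w) / P w ≤ (C′ w ∸ demand w) / P w
    F-at-w rewrite no-spare-at-w = z≤n
    U′<U : uncovered C′ < uncovered C
    U′<U = sumFin-≤-except₂ N (v≢w ∘ sym) U-at-w U-at-v λ x x≢w x≢v →
             ≤-reflexive (cong (demand x ∸_) (move-elsewhere P C x x≢v x≢w))
    F≤1+F′ : spareMoves C ≤ suc (spareMoves C′)
    F≤1+F′ = sumFin-≤-except₂ N v≢w F-at-v F-at-w λ x x≢v x≢w →
               ≤-reflexive (cong (λ c → (c ∸ demand x) / P x) (sym (move-elsewhere P C x x≢v x≢w)))
    U′≤F′ : uncovered C′ ≤ spareMoves C′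
    U′≤F′ = ≤-pred (≤-trans U′<U (≤-trans U≤F F≤1+F′))

  greedy : ∀ k {C} → uncovered C ≤ k → uncovered C ≤ spareMoves C →
           ∃ λ C′ → Derivable P C C′ × Covers C′ S
  greedy zero    {C} U≤0 _   = C , ε , uncovered≡0⇒covers (n≤0⇒n≡0 U≤0)
  greedy (suc k) {C} U≤k U≤F with uncovered C ℕ.≟ 0
  ... | yes U≡0 = C , ε , uncovered≡0⇒covers U≡0
  ... | no  U≢0 =
    let C′ , C→C′ , U′<U , U′≤F′ = greedy-step (n≢0⇒n>0 U≢0) U≤F
        C″ , C′⇒C″ , covers      = greedy k (≤-pred (<-≤-trans U′<U U≤k)) U′≤F′
    in  C″ , C→C′ ◅ C′⇒C″ , covers

  uncovered≤spareMoves⇒solvable : ∀ {C} → uncovered C ≤ spareMoves C →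
                                   ∃ λ C′ → Derivable P C C′ × Covers C′ S
  uncovered≤spareMoves⇒solvable = greedy _ ≤-refl

  size+M*uncovered≤ : ∀ {M} C → (∀ x → P x ≤ M) →
    size C + M * uncovered C ≤ M * (spareMoves C + ∣ S ∣) + sumOutside S (λ x → P x ∸ 1)
  size+M*uncovered≤ {M} C P≤M = begin
    size C + M * uncovered C
      ≡⟨ cong (size C +_) (sumFin-distribˡ-* N M (λ x → demand x ∸ C x)) ⟨
    size C + sumFin N (λ x → M * (demand x ∸ C x))
      ≡⟨ sumFin-distrib-+ N C (λ x → M * (demand x ∸ C x)) ⟨
    sumFin N (λ x → C x + M * (demand x ∸ C x))
      ≤⟨ sumFin-mono-≤ N (λ x → pebbles+M*uncovered≤ (lookup S x) (C x) (P≤M x)) ⟩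
    sumFin N (λ x → M * (spare x + demand x) + outside x)
      ≡⟨ sumFin-distrib-+ N (λ x → M * (spare x + demand x)) outside ⟩
    sumFin N (λ x → M * (spare x + demand x)) + sumOutside S (λ x → P x ∸ 1)
      ≡⟨ cong (_+ sumOutside S (λ x → P x ∸ 1)) (begin-equality
           sumFin N (λ x → M * (spare x + demand x))
             ≡⟨ sumFin-distribˡ-* N M _ ⟩
           M * sumFin N (λ x → spare x + demand x)
             ≡⟨ cong (M *_) (sumFin-distrib-+ N spare demand) ⟩
           M * (spareMoves C + sumFin N demand)
             ≡⟨ cong (λ k → M * (spareMoves C + k)) (sumFin-indicator S) ⟩
           M * (spareMoves C + ∣ S ∣) ∎) ⟩
    M * (spareMoves C + ∣ S ∣) + sumOutside S (λ x → P x ∸ 1) ∎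
    where
    open ≤-Reasoning
    spare outside : Fin N → ℕ
    spare x = (C x ∸ demand x) / P x
    outside x = if lookup S x then 0 else P x ∸ 1

module LowerBound (n : ℕ) (P : Fin (suc n) → ℕ) {{_ : ∀ {x} → NonZero (P x)}}
                  (t : ℕ) (t≤n : t ≤ n) where

  open Potential P

  targets : Subset (suc n)
  targets = firstVertices t

  ∣targets∣≡t : ∣ targets ∣ ≡ t
  ∣targets∣≡t = ∣firstVertices∣ (suc n) (m≤n⇒m≤1+n t≤n)

  extremal : Config (suc n)
  extremal x = (if lookup targets x then 0 else P x ∸ 1)
             + (if does (x ≟ fromℕ n) then P (fromℕ n) * (t ∸ 1) else 0)

  size-extremal : size extremal ≡ tailSum P t + P (fromℕ n) * (t ∸ 1)
  size-extremal = trans (sumFin-distrib-+ (suc n) outside onLast)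
                        (cong₂ _+_ (sym (tailSum≡sumOutside P t)) (sumFin-point (suc n) (fromℕ n) _))
    where
    outside onLast : Fin (suc n) → ℕ
    outside x = if lookup targets x then 0 else P x ∸ 1
    onLast  x = if does (x ≟ fromℕ n) then P (fromℕ n) * (t ∸ 1) else 0

  potential-below-extremal : ∀ {C} → (∀ x → C x ≤ extremal x) → potential targets C ≤ t ∸ 1
  potential-below-extremal {C} C≤extremal = begin
    potential targets C
      ≤⟨ sumFin-mono-≤ (suc n) at ⟩
    sumFin (suc n) (λ x → if does (x ≟ fromℕ n) then t ∸ 1 else 0)
      ≡⟨ sumFin-point (suc n) (fromℕ n) (t ∸ 1) ⟩
    t ∸ 1 ∎
    where
    open ≤-Reasoning
    at : ∀ x → (C x + offset targets x) / P x ≤ (if does (x ≟ fromℕ n) then t ∸ 1 else 0)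
    at x with lookup targets x in x∈ | x ≟ fromℕ n | C≤extremal x
    ... | true  | yes refl | _   =
      contradiction (<-≤-trans (∈firstVertices⇒< x∈) t≤n) (<-irrefl (Fin.toℕ-fromℕ n))
    ... | true  | no _     | Cx≤0 rewrite n≤0⇒n≡0 Cx≤0 =
      ≤-reflexive (m<n⇒m/n≡0 {P x ∸ 1} (m≤pred[n]⇒suc[m]≤n ≤-refl))
    ... | false | yes refl | Cx≤ = m≤[n∸1]+k*n⇒m/n≤k {P x} (t ∸ 1)
      (subst₂ _≤_ (sym (+-identityʳ _)) (cong (P x ∸ 1 +_) (*-comm (P x) (t ∸ 1))) Cx≤)
    ... | false | no _     | Cx≤ = m≤[n∸1]+k*n⇒m/n≤k {P x} 0
      (≤-trans (≤-reflexive (+-identityʳ (C x))) Cx≤)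

  lower-bound : 1 ≤ t → ∀ k → k < tailSum P t + P (fromℕ n) * (t ∸ 1) + 1 → ¬ AllSolvable P t k
  lower-bound 1≤t k k<m solvable =
    let C , C≤extremal , sizeC≡k = truncate (suc n) extremal k k≤size-extremal
        C′ , C⇒C′ , covers       = solvable C sizeC≡k targets ∣targets∣≡t
    in  potential<∣S∣⇒¬covers targets (potential<∣targets∣ C≤extremal) C⇒C′ covers
    where
    k≤size-extremal : k ≤ size extremal
    k≤size-extremal rewrite size-extremal = m<1+n⇒m≤n (subst (k <_) (+-comm _ 1) k<m)
    potential<∣targets∣ : ∀ {C} → (∀ x → C x ≤ extremal x) → potential targets C < ∣ targets ∣
    potential<∣targets∣ {C} C≤extremal = begin-strict
      potential targets C ≤⟨ potential-below-extremal C≤extremal ⟩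
      t ∸ 1               <⟨ m≤pred[n]⇒suc[m]≤n {{>-nonZero 1≤t}} ≤-refl ⟩
      t                   ≡⟨ ∣targets∣≡t ⟨
      ∣ targets ∣         ∎
      where open ≤-Reasoning

module UpperBound (n : ℕ) (P : Fin (suc n) → ℕ) {{_ : ∀ {x} → NonZero (P x)}}
                  (sorted : Monotone P) (t : ℕ) (1≤t : 1 ≤ t) where

  upper-bound : AllSolvable P t (tailSum P t + P (fromℕ n) * (t ∸ 1) + 1)
  upper-bound C sizeC≡ S ∣S∣≡t = uncovered≤spareMoves⇒solvable
    (m+n*k+1+n*u≤n*[f+1+k]+m⇒u≤f (tailSum P t) M (t ∸ 1) (uncovered C) (spareMoves C) counting)
    where
    open Greedy P S
    M : ℕ
    M = P (fromℕ n)
    q : Fin (suc n) → ℕ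
    q x = P x ∸ 1
    counting : tailSum P t + M * (t ∸ 1) + 1 + M * uncovered C
             ≤ M * (spareMoves C + suc (t ∸ 1)) + tailSum P t
    counting = begin
      tailSum P t + M * (t ∸ 1) + 1 + M * uncovered C
        ≡⟨ cong (_+ M * uncovered C) sizeC≡ ⟨
      size C + M * uncovered C
        ≤⟨ size+M*uncovered≤ C (λ x → sorted x (fromℕ n) (Fin.≤fromℕ x)) ⟩
      M * (spareMoves C + ∣ S ∣) + sumOutside S q
        ≤⟨ +-monoʳ-≤ (M * (spareMoves C + ∣ S ∣))
             (sumOutside≤sumOutside-firstVertices S q (λ i j i≤j → ∸-monoˡ-≤ 1 (sorted i j i≤j))) ⟩
      M * (spareMoves C + ∣ S ∣) + sumOutside (firstVertices ∣ S ∣) q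
        ≡⟨ cong (λ k → M * (spareMoves C + k) + sumOutside (firstVertices k) q) ∣S∣≡t ⟩
      M * (spareMoves C + t) + sumOutside (firstVertices t) q
        ≡⟨ cong₂ (λ k T → M * (spareMoves C + k) + T)
                 (sym (m+[n∸m]≡n 1≤t)) (sym (tailSum≡sumOutside P t)) ⟩
      M * (spareMoves C + suc (t ∸ 1)) + tailSum P t ∎
      where open ≤-Reasoning

theorem12 : (n : ℕ) (P : Fin (suc n) → ℕ) → IsPrice P
    → (∀ i j → toℕ i ≤ toℕ j → P i ≤ P j)
    → (t : ℕ) → 1 ≤ t → t < suc n
    → PebblingNumber P t (tailSum P t + P (fromℕ n) * (t ∸ 1) + 1)
theorem12 n P isPrice sorted t 1≤t t<1+n =
  UpperBound.upper-bound n P sorted t 1≤t ,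
  LowerBound.lower-bound n P t (≤-pred t<1+n) 1≤t
  where
  instance
    P≢0 : ∀ {x} → NonZero (P x)
    P≢0 {x} = >-nonZero (≤-trans (s≤s z≤n) (isPrice x))
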